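{- Let $P$ be an atom and let $B$ be the formula \[\bigl((\neg P\vee \neg P)\wedge(\neg P\vee\neg P)\bigr)\vee \bigl((P\vee P)\wedge(P\vee P)\bigr).\] Any proof of $B$ in the sequent calculus (with the six rules Axiom, Exchange, Weakening, Contraction, $\vee$-introduction, $\wedge$-introduction described below) must use both the weakening rule and the contraction rule. Equivalently, $B$ is provable neither in the sequent calculus system consisting of all rules except Weakening, nor in the system consisting of all rules except Contraction.
   Context: Formulas are built from propositional atoms using $\neg$, $\wedge$, $\vee$ (binary), with $\neg$ applied only to atoms ($\neg\neg F$, $\neg(F\wedge G)$, $\neg(F\vee G)$ being abbreviations for $F$, $\neg F\vee\neg G$, $\neg F\wedge\neg G$). A sequent is a nonempty finite sequence of formulas. The sequent calculus rules are ($F,G$ formulas, $\Gamma,\Delta$ possibly empty sequences of formulas): Axiom: $\neg F,F$ (no premises). Exchange: from $\Gamma,F,G,\Delta$ infer $\Gamma,G,F,\Delta$. Weakening: from $\Gamma,\Delta$ infer $\Gamma,F,\Delta$. Contraction: from $\Gamma,F,F,\Delta$ infer $\Gamma,F,\Delta$. $\vee$-introduction: from $\Gamma,F,G,\Delta$ infer $\Gamma,F\vee G,\Delta$. $\wedge$-introduction: from the two premises $\Gamma,F$ and $G,\Delta$ infer $\Gamma,F\wedge G,\Delta$. A sequent calculus system is a subset of these rules; a sequent is provable in it if it is the root of a finite tree of sequents each node of which follows from its children by a rule of the system; a formula is provable if the one-element sequent consisting of it is provable. -}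

module Defs where

open import Data.Nat using (ℕ)
open import Data.List using (List; []; _∷_; _++_)
open import Data.List.NonEmpty using (List⁺; _∷_)
open import Relation.Binary.PropositionalEquality using (_≡_)
open import Relation.Nullary using (¬_)

Atom : Set
Atom = ℕ

-- Formulas in negation normal form: negation applied only to atoms.
data Formula : Set where
  atom  : Atom → Formula
  natom : Atom → Formula
  _∧′_  : Formula → Formula → Formula
  _∨′_  : Formula → Formula → Formula

infixr 6 _∧′_
infixr 5 _∨′_

neg : Formula → Formula
neg (atom p)  = natom p
neg (natom p) = atom p
neg (F ∧′ G)  = neg F ∨′ neg G
neg (F ∨′ G)  = neg F ∧′ neg G

Sequent : Set
Sequent = List⁺ Formula

_⸴_⸴_ : List Formula → Formula → List Formula → Sequent
[] ⸴ F ⸴ Δ = F ∷ Δ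
(A ∷ Γ) ⸴ F ⸴ Δ = A ∷ (Γ ++ F ∷ Δ)

data Rule : Set where
  axiom exchange weakening contraction ∨-intro ∧-intro : Rule

System : Set₁
System = Rule → Set

data ⊢[_]_ (S : System) : Sequent → Set where
  ax   : S axiom → (F : Formula) → ⊢[ S ] (neg F ∷ F ∷ [])
  exch : S exchange → (Γ : List Formula) (F G : Formula) (Δ : List Formula) →
         ⊢[ S ] (Γ ⸴ F ⸴ (G ∷ Δ)) → ⊢[ S ] (Γ ⸴ G ⸴ (F ∷ Δ))
  weak : S weakening → (Γ : List Formula) (F : Formula) (Δ : List Formula) →
         (ne : List⁺ Formula) → Data.List.NonEmpty.toList ne ≡ Γ ++ Δ →
         ⊢[ S ] ne → ⊢[ S ] (Γ ⸴ F ⸴ Δ)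
  contr : S contraction → (Γ : List Formula) (F : Formula) (Δ : List Formula) →
          ⊢[ S ] (Γ ⸴ F ⸴ (F ∷ Δ)) → ⊢[ S ] (Γ ⸴ F ⸴ Δ)
  or-i : S ∨-intro → (Γ : List Formula) (F G : Formula) (Δ : List Formula) →
         ⊢[ S ] (Γ ⸴ F ⸴ (G ∷ Δ)) → ⊢[ S ] (Γ ⸴ (F ∨′ G) ⸴ Δ)
  and-i : S ∧-intro → (Γ : List Formula) (F G : Formula) (Δ : List Formula) →
          ⊢[ S ] (Γ ⸴ F ⸴ []) → ⊢[ S ] ([] ⸴ G ⸴ Δ) →
          ⊢[ S ] (Γ ⸴ (F ∧′ G) ⸴ Δ)

Provable : System → Formula → Set
Provable S F = ⊢[ S ] (F ∷ [])

allBut : Rule → System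
allBut r r′ = ¬ (r′ ≡ r)

B : Atom → Formula
B P = ((natom P ∨′ natom P) ∧′ (natom P ∨′ natom P))
      ∨′ ((atom P ∨′ atom P) ∧′ (atom P ∨′ atom P))

{-# OPTIONS --safe #-}

-- Read a sequent as the ⅋ of its formulas in a commutative monoid with an
-- involution `dual`, interpreting ∨ by ⅋ and ∧ by its De Morgan dual ⊗, and
-- call it valid when its value is designated.  Each rule preserves validity as
-- soon as the model satisfies the matching closure condition `Validates`.  A
-- five-element model satisfying every condition but the one for weakening, and a
-- six-element model satisfying every condition but the one for contraction, both
-- leave B undesignated; their conditions are checked by exhaustive evaluation.

module Submission where

open import Defs
open import Algebra.Bundles using (CommutativeMonoid)
open import Algebra.Core using (Op₁; Op₂)
open import Algebra.Definitions using (Involutive)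
open import Algebra.Structures using (IsCommutativeMonoid)
open import Algebra.Structures.Biased using (isCommutativeMonoidˡ)
import Algebra.Properties.CommutativeSemigroup as CommutativeSemigroupProperties
open import Data.Empty using (⊥-elim)
open import Data.Fin using (Fin; zero; suc)
open import Data.Fin.Properties using (all?; _≟_)
open import Data.List using (List; []; _∷_; _++_)
open import Data.List.NonEmpty using (toList)
open import Data.Product using (_×_; _,_)
open import Data.Unit using (⊤; tt)
open import Level using (0ℓ)
open import Relation.Binary.PropositionalEquality
  using (_≡_; _≢_; refl; sym; trans; cong; cong₂; subst; module ≡-Reasoning)
open import Relation.Binary.PropositionalEquality.Algebra using (isMagma)
open import Relation.Nullary using (¬_; Dec)
open import Relation.Nullary.Decidable using (from-yes; ¬?; _→-dec_)
open import Relation.Unary using (Pred)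

record Model : Set₁ where
  infixr 6 _⅋_
  infixr 7 _⊗_
  field
    Carrier               : Set
    _⅋_                   : Op₂ Carrier
    ε                     : Carrier
    dual                  : Op₁ Carrier
    Designated            : Pred Carrier 0ℓ
    ⅋-isCommutativeMonoid : IsCommutativeMonoid _≡_ _⅋_ ε
    dual-involutive       : Involutive _≡_ dual

  _⊗_ : Op₂ Carrier
  f ⊗ g = dual (dual f ⅋ dual g)

  -- Exchange and ∨-introduction are sound in every model, since ⅋ is
  -- commutative and associative.
  Validates : Rule → Set
  Validates axiom       = ∀ a → Designated (dual a ⅋ a)
  Validates exchange    = ⊤
  Validates weakening   = ∀ f z → Designated z → Designated (f ⅋ z)
  Validates contraction = ∀ f z → Designated (f ⅋ f ⅋ z) → Designated (f ⅋ z)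
  Validates ∨-intro     = ⊤
  Validates ∧-intro     = ∀ x f g y → Designated (x ⅋ f) → Designated (g ⅋ y) →
                          Designated (x ⅋ f ⊗ g ⅋ y)

  open IsCommutativeMonoid ⅋-isCommutativeMonoid public
    using (assoc; identityˡ; identityʳ)

  ⅋-commutativeMonoid : CommutativeMonoid 0ℓ 0ℓ
  ⅋-commutativeMonoid = record { isCommutativeMonoid = ⅋-isCommutativeMonoid }

  open CommutativeSemigroupProperties
    (CommutativeMonoid.commutativeSemigroup ⅋-commutativeMonoid) public
    using (x∙yz≈y∙xz)

module Semantics (M : Model) (ρ : Atom → Model.Carrier M) where
  open Model M
  open ≡-Reasoning

  ⟦_⟧ : Formula → Carrier
  ⟦ atom q ⟧  = ρ q
  ⟦ natom q ⟧ = dual (ρ q)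
  ⟦ F ∧′ G ⟧  = ⟦ F ⟧ ⊗ ⟦ G ⟧
  ⟦ F ∨′ G ⟧  = ⟦ F ⟧ ⅋ ⟦ G ⟧

  ⟦neg⟧ : ∀ F → ⟦ neg F ⟧ ≡ dual ⟦ F ⟧
  dual-⟦neg⟧ : ∀ F → dual ⟦ neg F ⟧ ≡ ⟦ F ⟧

  ⟦neg⟧ (atom q)  = refl
  ⟦neg⟧ (natom q) = sym (dual-involutive (ρ q))
  ⟦neg⟧ (F ∧′ G)  = trans (cong₂ _⅋_ (⟦neg⟧ F) (⟦neg⟧ G)) (sym (dual-involutive _))
  ⟦neg⟧ (F ∨′ G)  = cong dual (cong₂ _⅋_ (dual-⟦neg⟧ F) (dual-⟦neg⟧ G))

  dual-⟦neg⟧ F = trans (cong dual (⟦neg⟧ F)) (dual-involutive ⟦ F ⟧)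

  ⟦_⟧* : List Formula → Carrier
  ⟦ [] ⟧*    = ε
  ⟦ F ∷ Γ ⟧* = ⟦ F ⟧ ⅋ ⟦ Γ ⟧*

  ⟦++⟧ : ∀ Γ Δ → ⟦ Γ ++ Δ ⟧* ≡ ⟦ Γ ⟧* ⅋ ⟦ Δ ⟧*
  ⟦++⟧ []      Δ = sym (identityˡ ⟦ Δ ⟧*)
  ⟦++⟧ (F ∷ Γ) Δ = trans (cong (⟦ F ⟧ ⅋_) (⟦++⟧ Γ Δ)) (sym (assoc ⟦ F ⟧ ⟦ Γ ⟧* ⟦ Δ ⟧*))

  ⟦_⟧ˢ : Sequent → Carrier
  ⟦ s ⟧ˢ = ⟦ toList s ⟧*

  ⟦⸴⸴⟧ : ∀ Γ F Δ → ⟦ Γ ⸴ F ⸴ Δ ⟧ˢ ≡ ⟦ Γ ⟧* ⅋ ⟦ F ⟧ ⅋ ⟦ Δ ⟧*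
  ⟦⸴⸴⟧ []      F Δ = sym (identityˡ _)
  ⟦⸴⸴⟧ (A ∷ Γ) F Δ = trans (cong (⟦ A ⟧ ⅋_) (⟦++⟧ Γ (F ∷ Δ))) (sym (assoc ⟦ A ⟧ ⟦ Γ ⟧* _))

  soundness : ∀ {S} → (∀ {r} → S r → Validates r) → ∀ {s} → ⊢[ S ] s → Designated ⟦ s ⟧ˢ
  soundness valid (ax r F) =
    subst Designated (cong₂ _⅋_ (sym (⟦neg⟧ F)) (sym (identityʳ ⟦ F ⟧))) (valid r ⟦ F ⟧)
  soundness valid (exch _ Γ F G Δ d) = subst Designated (begin
    ⟦ Γ ⸴ F ⸴ (G ∷ Δ) ⟧ˢ                    ≡⟨ ⟦⸴⸴⟧ Γ F (G ∷ Δ) ⟩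
    ⟦ Γ ⟧* ⅋ ⟦ F ⟧ ⅋ ⟦ G ⟧ ⅋ ⟦ Δ ⟧*       ≡⟨ cong (⟦ Γ ⟧* ⅋_) (x∙yz≈y∙xz ⟦ F ⟧ ⟦ G ⟧ ⟦ Δ ⟧*) ⟩
    ⟦ Γ ⟧* ⅋ ⟦ G ⟧ ⅋ ⟦ F ⟧ ⅋ ⟦ Δ ⟧*       ≡⟨ ⟦⸴⸴⟧ Γ G (F ∷ Δ) ⟨
    ⟦ Γ ⸴ G ⸴ (F ∷ Δ) ⟧ˢ                    ∎) (soundness valid d)
  soundness valid (weak r Γ F Δ ne ne≡ΓΔ d) = subst Designated (begin
    ⟦ F ⟧ ⅋ ⟦ toList ne ⟧*                ≡⟨ cong (λ Λ → ⟦ F ⟧ ⅋ ⟦ Λ ⟧*) ne≡ΓΔ ⟩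
    ⟦ F ⟧ ⅋ ⟦ Γ ++ Δ ⟧*                   ≡⟨ cong (⟦ F ⟧ ⅋_) (⟦++⟧ Γ Δ) ⟩
    ⟦ F ⟧ ⅋ ⟦ Γ ⟧* ⅋ ⟦ Δ ⟧*               ≡⟨ x∙yz≈y∙xz ⟦ F ⟧ ⟦ Γ ⟧* ⟦ Δ ⟧* ⟩
    ⟦ Γ ⟧* ⅋ ⟦ F ⟧ ⅋ ⟦ Δ ⟧*               ≡⟨ ⟦⸴⸴⟧ Γ F Δ ⟨
    ⟦ Γ ⸴ F ⸴ Δ ⟧ˢ                        ∎) (valid r ⟦ F ⟧ _ (soundness valid d))
  soundness valid (contr r Γ F Δ d) =
    subst Designated conclusion (valid r ⟦ F ⟧ _ (subst Designated premise (soundness valid d)))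
    where
    γ = ⟦ Γ ⟧*
    f = ⟦ F ⟧
    δ = ⟦ Δ ⟧*
    premise : ⟦ Γ ⸴ F ⸴ (F ∷ Δ) ⟧ˢ ≡ f ⅋ f ⅋ γ ⅋ δ
    premise = begin
      ⟦ Γ ⸴ F ⸴ (F ∷ Δ) ⟧ˢ ≡⟨ ⟦⸴⸴⟧ Γ F (F ∷ Δ) ⟩
      γ ⅋ f ⅋ f ⅋ δ      ≡⟨ x∙yz≈y∙xz γ f (f ⅋ δ) ⟩
      f ⅋ γ ⅋ f ⅋ δ      ≡⟨ cong (f ⅋_) (x∙yz≈y∙xz γ f δ) ⟩
      f ⅋ f ⅋ γ ⅋ δ      ∎
    conclusion : f ⅋ γ ⅋ δ ≡ ⟦ Γ ⸴ F ⸴ Δ ⟧ˢ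
    conclusion = trans (x∙yz≈y∙xz f γ δ) (sym (⟦⸴⸴⟧ Γ F Δ))
  soundness valid (or-i _ Γ F G Δ d) = subst Designated (begin
    ⟦ Γ ⸴ F ⸴ (G ∷ Δ) ⟧ˢ                    ≡⟨ ⟦⸴⸴⟧ Γ F (G ∷ Δ) ⟩
    ⟦ Γ ⟧* ⅋ ⟦ F ⟧ ⅋ ⟦ G ⟧ ⅋ ⟦ Δ ⟧*       ≡⟨ cong (⟦ Γ ⟧* ⅋_) (assoc ⟦ F ⟧ ⟦ G ⟧ ⟦ Δ ⟧*) ⟨
    ⟦ Γ ⟧* ⅋ (⟦ F ⟧ ⅋ ⟦ G ⟧) ⅋ ⟦ Δ ⟧*     ≡⟨ ⟦⸴⸴⟧ Γ (F ∨′ G) Δ ⟨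
    ⟦ Γ ⸴ (F ∨′ G) ⸴ Δ ⟧ˢ                   ∎) (soundness valid d)
  soundness valid (and-i r Γ F G Δ dF dG) =
    subst Designated (sym (⟦⸴⸴⟧ Γ (F ∧′ G) Δ)) (valid r ⟦ Γ ⟧* ⟦ F ⟧ ⟦ G ⟧ ⟦ Δ ⟧* left right)
    where
    left : Designated (⟦ Γ ⟧* ⅋ ⟦ F ⟧)
    left = subst Designated (trans (⟦⸴⸴⟧ Γ F []) (cong (⟦ Γ ⟧* ⅋_) (identityʳ ⟦ F ⟧)))
                 (soundness valid dF)
    right : Designated (⟦ G ⟧ ⅋ ⟦ Δ ⟧*)
    right = soundness valid dG

  unprovable : ∀ {S F} → (∀ {r} → S r → Validates r) → ¬ Designated ⟦ F ⟧ → ¬ Provable S F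
  unprovable {F = F} valid F-undesignated d =
    F-undesignated (subst Designated (identityʳ ⟦ F ⟧) (soundness valid d))

-- w0, w1, w2 count the literals of a formula, ∨ adding weights and ∧ adding
-- them and subtracting two, so every axiom weighs two; w3 means "at least three"
-- and its dual `top` absorbs everything.  Dropping one copy of a duplicated
-- formula never raises the weight, so contraction is sound; weakening is not, and
-- B weighs four.
module Counting where
  pattern w0  = zero
  pattern w1  = suc zero
  pattern w2  = suc (suc zero)
  pattern w3  = suc (suc (suc zero))
  pattern top = suc (suc (suc (suc zero)))

  infixr 6 _⅋_
  _⅋_ : Op₂ (Fin 5)
  top ⅋ _   = top
  _   ⅋ top = top
  w0  ⅋ y   = y
  x   ⅋ w0  = x
  w1  ⅋ w1  = w2
  _   ⅋ _   = w3

  dual : Op₁ (Fin 5)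
  dual w0  = w2
  dual w1  = w1
  dual w2  = w0
  dual w3  = top
  dual top = w3

  model : Model
  model = record
    { Carrier               = Fin 5
    ; _⅋_                   = _⅋_
    ; ε                     = w0
    ; dual                  = dual
    ; Designated            = _≢ w3
    ; ⅋-isCommutativeMonoid = isCommutativeMonoidˡ record
        { isSemigroup = record
            { isMagma = isMagma _⅋_
            ; assoc   = from-yes (all? λ x → all? λ y → all? λ z → (x ⅋ y) ⅋ z ≟ x ⅋ (y ⅋ z))
            }
        ; identityˡ   = from-yes (all? λ x → w0 ⅋ x ≟ x)
        ; comm        = from-yes (all? λ x → all? λ y → x ⅋ y ≟ y ⅋ x)
        }
    ; dual-involutive       = from-yes (all? λ x → dual (dual x) ≟ x)
    }

  open Model model using (Validates; _⊗_)

  designated? : (x : Fin 5) → Dec (x ≢ w3)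
  designated? x = ¬? (x ≟ w3)

  validates-allBut-weakening : ∀ {r} → allBut weakening r → Validates r
  validates-allBut-weakening {axiom}       _ = from-yes (all? λ a → designated? (dual a ⅋ a))
  validates-allBut-weakening {exchange}    _ = tt
  validates-allBut-weakening {weakening}   r≢w = ⊥-elim (r≢w refl)
  validates-allBut-weakening {contraction} _ = from-yes (all? λ f → all? λ z →
    designated? (f ⅋ f ⅋ z) →-dec designated? (f ⅋ z))
  validates-allBut-weakening {∨-intro}     _ = tt
  validates-allBut-weakening {∧-intro}     _ = from-yes (all? λ x → all? λ f → all? λ g → all? λ y →
    designated? (x ⅋ f) →-dec designated? (g ⅋ y) →-dec designated? (x ⅋ f ⊗ g ⅋ y))

-- p, p̄ and q̄ play the role of single formulas; q is a sum of two of them other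
-- than the complementary pair p ⅋ p̄, and every other sum avoiding the unit ∅ is
-- `top`, the only designated value.  Weakening is sound because `top` is absorbing; B has value q.
module Pairing where
  pattern ∅   = zero
  pattern top = suc zero
  pattern p   = suc (suc zero)
  pattern p̄   = suc (suc (suc zero))
  pattern q   = suc (suc (suc (suc zero)))
  pattern q̄   = suc (suc (suc (suc (suc zero))))

  infixr 6 _⅋_
  _⅋_ : Op₂ (Fin 6)
  ∅   ⅋ y   = y
  x   ⅋ ∅   = x
  top ⅋ _   = top
  _   ⅋ top = top
  q   ⅋ _   = top
  _   ⅋ q   = top
  p   ⅋ p̄   = top
  p̄   ⅋ p   = top
  _   ⅋ _   = q

  dual : Op₁ (Fin 6)
  dual ∅   = top
  dual top = ∅
  dual p   = p̄
  dual p̄   = p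
  dual q   = q̄
  dual q̄   = q

  model : Model
  model = record
    { Carrier               = Fin 6
    ; _⅋_                   = _⅋_
    ; ε                     = ∅
    ; dual                  = dual
    ; Designated            = _≡ top
    ; ⅋-isCommutativeMonoid = isCommutativeMonoidˡ record
        { isSemigroup = record
            { isMagma = isMagma _⅋_
            ; assoc   = from-yes (all? λ x → all? λ y → all? λ z → (x ⅋ y) ⅋ z ≟ x ⅋ (y ⅋ z))
            }
        ; identityˡ   = from-yes (all? λ x → ∅ ⅋ x ≟ x)
        ; comm        = from-yes (all? λ x → all? λ y → x ⅋ y ≟ y ⅋ x)
        }
    ; dual-involutive       = from-yes (all? λ x → dual (dual x) ≟ x)
    }

  open Model model using (Validates; _⊗_)

  designated? : (x : Fin 6) → Dec (x ≡ top)
  designated? x = x ≟ top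

  validates-allBut-contraction : ∀ {r} → allBut contraction r → Validates r
  validates-allBut-contraction {axiom}       _ = from-yes (all? λ a → designated? (dual a ⅋ a))
  validates-allBut-contraction {exchange}    _ = tt
  validates-allBut-contraction {weakening}   _ = from-yes (all? λ f → all? λ z →
    designated? z →-dec designated? (f ⅋ z))
  validates-allBut-contraction {contraction} r≢c = ⊥-elim (r≢c refl)
  validates-allBut-contraction {∨-intro}     _ = tt
  validates-allBut-contraction {∧-intro}     _ = from-yes (all? λ x → all? λ f → all? λ g → all? λ y →
    designated? (x ⅋ f) →-dec designated? (g ⅋ y) →-dec designated? (x ⅋ f ⊗ g ⅋ y))

fact5p1 : (P : Atom) →
    ¬ Provable (allBut weakening) (B P) × ¬ Provable (allBut contraction) (B P)
fact5p1 P =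
    Semantics.unprovable Counting.model (λ _ → Counting.w1)
      Counting.validates-allBut-weakening (λ B≢w3 → B≢w3 refl)
  , Semantics.unprovable Pairing.model (λ _ → Pairing.p)
      Pairing.validates-allBut-contraction (λ ())
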